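{- Let $p$ be a prime, $t\ge1$, and $a$ an integer not divisible by $p$. For an integer $k$, $(2k \bmod p^t)\in \bar{D}_2(a;p^t)$ if and only if $k^2+a$ is a square modulo $p^t$. Moreover, the map $f(k)=2k \bmod p^t$ defines a bijection $$f:\{k: k^2+a \text{ is a square} \bmod p^t,\ 0\le k<p^t\}\to \bar{D}_2(a;p^t)$$ when $p>2$, and when $p=2$ it defines a bijection $$f:\{k: k^2+a \text{ is a square} \bmod 2^t,\ 0\le k<2^{t-1}\}\to \bar{D}_2(a;2^t).$$
   Context: For $n\ge2$ and $a$ coprime to $n$, $H_2(a;n)=\{(x,y)\in\mathbb{Z}^2: xy\equiv a \bmod n,\ 1\le x,y<n\}$ and $\bar{D}_2(a;n)=\{x-y \bmod n:(x,y)\in H_2(a;n)\}\subseteq\mathbb{Z}/n\mathbb{Z}$. An integer $c$ is a square modulo $N$ if $c\equiv x^2 \bmod N$ for some integer $x$. -}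

module Defs where

open import Data.Nat as ℕ using (ℕ; NonZero)
open import Data.Integer using (ℤ; +_; _+_; _-_; _*_; _≤_; _<_; _%ℕ_)
open import Data.Integer.Divisibility using (_∣_)
open import Data.Product using (Σ; ∃; _×_)
open import Relation.Binary.PropositionalEquality using (_≡_)

infix 4 _≡_[mod_]
_≡_[mod_] : ℤ → ℤ → ℕ → Set
b ≡ c [mod n ] = (+ n) ∣ (b - c)

H₂ : ℤ → ℕ → ℤ → ℤ → Set
H₂ a n x y = (+ 1 ≤ x) × (x < + n) × (+ 1 ≤ y) × (y < + n) × ((x * y) ≡ a [mod n ])

-- D̄₂(a;n) ⊆ ℤ/nℤ, where ℤ/nℤ is represented by the residues {0,…,n-1} ⊆ ℕ:
-- r ∈ D̄₂(a;n)  iff  r = (x - y) mod n for some (x,y) ∈ H₂(a;n)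
D̄₂ : ℤ → (n : ℕ) → .{{NonZero n}} → ℕ → Set
D̄₂ a n r = ∃ λ x → ∃ λ y → H₂ a n x y × ((x - y) %ℕ n ≡ r)

IsSquareMod : ℤ → ℕ → Set
IsSquareMod c N = ∃ λ x → c ≡ x * x [mod N ]

f : (n : ℕ) → .{{NonZero n}} → ℤ → ℕ
f n k = (+ 2 * k) %ℕ n

Dom : ℤ → ℕ → ℕ → ℤ → Set
Dom a n bound k = (+ 0 ≤ k) × (k < + bound) × IsSquareMod (k * k + a) n

FBijection : (a : ℤ) (n : ℕ) .{{_ : NonZero n}} (bound : ℕ) → Set
FBijection a n bound =
  (∀ k → Dom a n bound k → D̄₂ a n (f n k))
  × (∀ k k′ → Dom a n bound k → Dom a n bound k′ → f n k ≡ f n k′ → k ≡ k′)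
  × (∀ r → D̄₂ a n r → ∃ λ k → Dom a n bound k × (f n k ≡ r))

{-# OPTIONS --safe #-}
module Submission where

open import Defs
open import Data.Nat using (ℕ; _^_; _≤_; _∸_; NonZero)
open import Data.Nat.Primality using (Prime)
open import Data.Integer using (ℤ; +_; _+_; _*_)
open import Data.Integer.Divisibility using (_∣_)
open import Data.Product using (_×_)
open import Function.Bundles using (_⇔_)
open import Relation.Nullary using (¬_)
open import Relation.Binary.PropositionalEquality using (_≡_; _≢_)

open import Data.Nat as ℕ using (zero; suc; z≤n; s≤s)
import Data.Nat.Properties as ℕ
import Data.Nat.Divisibility as ℕDiv
open import Data.Nat.DivMod using (_%_; _/_; m≡m%n+[m/n]*n; m%n<n; m<n⇒m%n≡m)
open import Data.Nat.Primality using (euclidsLemma; prime[2]; prime⇒irreducible; ¬prime[1])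
open import Data.Integer as ℤ using (_-_; 0ℤ; 1ℤ; _%ℕ_; _/ℕ_; +≤+; +<+)
import Data.Integer.Properties as ℤ
open import Data.Integer.DivMod using (n%ℕd<d; a≡a%ℕn+[a/ℕn]*n)
import Data.Integer.Divisibility.Signed as Signed
open import Data.Integer.Tactic.RingSolver using (solve; solve-∀)
open import Data.List using (_∷_; [])
open import Data.Product using (∃; ∃₂; _,_)
open import Data.Sum using (_⊎_; inj₁; inj₂)
open import Data.Empty using (⊥-elim)
open import Function.Base using (_∘_)
open import Function.Bundles using (mk⇔)
open import Level using (0ℓ)
open import Relation.Binary.Bundles using (Setoid)
open import Relation.Binary.PropositionalEquality using (refl; sym; trans; cong; subst; module ≡-Reasoning)
import Relation.Binary.Reasoning.Setoid as SetoidReasoning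

-- If xy ≡ a and x − y ≡ 2k (mod n), then (y + k)² ≡ k² + a; conversely, if z² ≡ k² + a,
-- then x = z + k, y = z − k satisfy xy ≡ a and x − y = 2k, and p ∤ a keeps their
-- residues nonzero.  So 2k mod n lies in D̄₂(a;n) exactly when k² + a is a square.
-- For odd n = p^t, doubling is invertible mod n, so k ↦ 2k mod n is a bijection of
-- the residues.  For n = 2^t with a odd, the factors x, y are odd, so D̄₂ consists of
-- even residues 2j with j < 2^(t−1), and on these j ↦ 2j is injective.

-- Defs' congruence with signed divisibility, wrapped in a record so that both sides
-- can be inferred from a proof.
infix 4 _≋_[mod_]
record _≋_[mod_] (b c : ℤ) (N : ℕ) : Set where
  constructor congruent
  field divides-difference : + N Signed.∣ b - c
open _≋_[mod_]

≋⇒≡[mod] : ∀ {b c N} → b ≋ c [mod N ] → b ≡ c [mod N ]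
≋⇒≡[mod] b≋c = Signed.∣⇒∣ᵤ (divides-difference b≋c)

≡[mod]⇒≋ : ∀ {b c N} → b ≡ c [mod N ] → b ≋ c [mod N ]
≡[mod]⇒≋ b≡c = congruent (Signed.∣ᵤ⇒∣ b≡c)

≋0⇒∣ : ∀ {a N} → a ≋ 0ℤ [mod N ] → + N ∣ a
≋0⇒∣ {a} {N} a≋0 = subst (+ N ∣_) (ℤ.+-identityʳ a) (≋⇒≡[mod] a≋0)

module _ {N : ℕ} where

  ≋-reflexive : ∀ {b c} → b ≡ c → b ≋ c [mod N ]
  ≋-reflexive {b} refl = congruent (Signed.divides 0ℤ (ℤ.+-inverseʳ b))

  ≋-refl : ∀ b → b ≋ b [mod N ]
  ≋-refl b = ≋-reflexive refl

  ≋-sym : ∀ {b c} → b ≋ c [mod N ] → c ≋ b [mod N ]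
  ≋-sym {b} {c} (congruent N∣b-c) =
    congruent (subst (+ N Signed.∣_) eq (Signed.∣m⇒∣-m N∣b-c))
    where
    eq : ℤ.- (b - c) ≡ c - b
    eq = solve (b ∷ c ∷ [])

  ≋-trans : ∀ {a b c} → a ≋ b [mod N ] → b ≋ c [mod N ] → a ≋ c [mod N ]
  ≋-trans {a} {b} {c} (congruent N∣a-b) (congruent N∣b-c) =
    congruent (subst (+ N Signed.∣_) (ℤ.+-minus-telescope a b c)
      (Signed.∣m∣n⇒∣m+n N∣a-b N∣b-c))

  +-cong : ∀ {a b c d} → a ≋ b [mod N ] → c ≋ d [mod N ] → a + c ≋ b + d [mod N ]
  +-cong {a} {b} {c} {d} (congruent N∣a-b) (congruent N∣c-d) =
    congruent (subst (+ N Signed.∣_) eq (Signed.∣m∣n⇒∣m+n N∣a-b N∣c-d))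
    where
    eq : (a - b) + (c - d) ≡ (a + c) - (b + d)
    eq = solve (a ∷ b ∷ c ∷ d ∷ [])

  -‿cong₂ : ∀ {a b c d} → a ≋ b [mod N ] → c ≋ d [mod N ] → a - c ≋ b - d [mod N ]
  -‿cong₂ {a} {b} {c} {d} (congruent N∣a-b) (congruent N∣c-d) =
    congruent (subst (+ N Signed.∣_) eq (Signed.∣m∣n⇒∣m-n N∣a-b N∣c-d))
    where
    eq : (a - b) - (c - d) ≡ (a - c) - (b - d)
    eq = solve (a ∷ b ∷ c ∷ d ∷ [])

  *-cong : ∀ {a b c d} → a ≋ b [mod N ] → c ≋ d [mod N ] → a * c ≋ b * d [mod N ]
  *-cong {a} {b} {c} {d} (congruent N∣a-b) (congruent N∣c-d) =
    congruent (subst (+ N Signed.∣_) eq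
      (Signed.∣m∣n⇒∣m+n (Signed.∣n⇒∣m*n c N∣a-b) (Signed.∣n⇒∣m*n b N∣c-d)))
    where
    eq : c * (a - b) + b * (c - d) ≡ a * c - b * d
    eq = solve (a ∷ b ∷ c ∷ d ∷ [])

≋-setoid : ℕ → Setoid 0ℓ 0ℓ
≋-setoid N = record
  { Carrier       = ℤ
  ; _≈_           = λ b c → b ≋ c [mod N ]
  ; isEquivalence = record { refl = ≋-refl _ ; sym = ≋-sym ; trans = ≋-trans }
  }

≋-mod-∣ : ∀ {M N b c} → M ℕDiv.∣ N → b ≋ c [mod N ] → b ≋ c [mod M ]
≋-mod-∣ M∣N (congruent N∣b-c) = congruent (Signed.∣-trans (Signed.∣ᵤ⇒∣ M∣N) N∣b-c)

*-cancelˡ-≋ : ∀ {N} u d {b c} → u * d ≋ 1ℤ [mod N ] →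
  d * b ≋ d * c [mod N ] → b ≋ c [mod N ]
*-cancelˡ-≋ {N} u d {b} {c} ud≋1 db≋dc = begin
  b           ≡⟨ ℤ.*-identityˡ b ⟨
  1ℤ * b      ≈⟨ *-cong (≋-sym ud≋1) (≋-refl b) ⟩
  u * d * b   ≡⟨ ℤ.*-assoc u d b ⟩
  u * (d * b) ≈⟨ *-cong (≋-refl u) db≋dc ⟩
  u * (d * c) ≡⟨ ℤ.*-assoc u d c ⟨
  u * d * c   ≈⟨ *-cong ud≋1 (≋-refl c) ⟩
  1ℤ * c      ≡⟨ ℤ.*-identityˡ c ⟩
  c           ∎
  where open SetoidReasoning (≋-setoid N)

module _ {N : ℕ} .{{_ : NonZero N}} where

  ≋-%ℕ : ∀ x → x ≋ + (x %ℕ N) [mod N ]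
  ≋-%ℕ x = congruent (Signed.divides q
    (trans (cong (_- + r) (a≡a%ℕn+[a/ℕn]*n x N)) (m+n-m≡n (+ r) (q * + N))))
    where
    r = x %ℕ N
    q = x /ℕ N
    m+n-m≡n : ∀ m n → (m + n) - m ≡ n
    m+n-m≡n = solve-∀

  residue-unique : ∀ {r s} → r ℕ.< N → s ℕ.< N → + r ≋ + s [mod N ] → r ≡ s
  residue-unique {r} {s} r<N s<N (congruent N∣r-s) =
    ℤ.+-injective (ℤ.i-j≡0⇒i≡j (+ r) (+ s) (ℤ.∣i∣≡0⇒i≡0 ∣r-s∣≡0))
    where
    ∣r-s∣<N : ℤ.∣ + r - + s ∣ ℕ.< N
    ∣r-s∣<N = subst (ℕ._< N) (cong ℤ.∣_∣ (sym (ℤ.[+m]-[+n]≡m⊖n r s)))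
      (ℕ.≤-<-trans (ℤ.∣m⊝n∣≤m⊔n r s) (ℕ.⊔-lub r<N s<N))
    ∣r-s∣≡0 : ℤ.∣ + r - + s ∣ ≡ 0
    ∣r-s∣≡0 = trans (sym (m<n⇒m%n≡m ∣r-s∣<N))
      (ℕDiv.n∣m⇒m%n≡0 _ N (Signed.∣⇒∣ᵤ N∣r-s))

  %ℕ-cong : ∀ {b c} → b ≋ c [mod N ] → b %ℕ N ≡ c %ℕ N
  %ℕ-cong {b} {c} b≋c = residue-unique (n%ℕd<d b N) (n%ℕd<d c N)
    (≋-trans (≋-sym (≋-%ℕ b)) (≋-trans b≋c (≋-%ℕ c)))

  %ℕ-≡⇒≋ : ∀ {b c} → b %ℕ N ≡ c %ℕ N → b ≋ c [mod N ]
  %ℕ-≡⇒≋ {b} {c} b%N≡c%N =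
    ≋-trans (≋-%ℕ b) (≋-trans (≋-reflexive (cong +_ b%N≡c%N)) (≋-sym (≋-%ℕ c)))

  %ℕ-positive : ∀ x → ¬ (x ≋ 0ℤ [mod N ]) → + 1 ℤ.≤ + (x %ℕ N)
  %ℕ-positive x x≉0 with x %ℕ N | ≋-%ℕ x
  ... | zero   | x≋0 = ⊥-elim (x≉0 x≋0)
  ... | suc _  | _   = +≤+ (s≤s z≤n)

module _ (a : ℤ) {N : ℕ} .{{_ : NonZero N}} where
  open SetoidReasoning (≋-setoid N)

  D̄₂-intro : ∀ x y → ¬ (a ≋ 0ℤ [mod N ]) → x * y ≋ a [mod N ] → D̄₂ a N ((x - y) %ℕ N)
  D̄₂-intro x y a≉0 xy≋a =
    + (x %ℕ N) , + (y %ℕ N) ,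
    (%ℕ-positive x x≉0 , +<+ (n%ℕd<d x N) , %ℕ-positive y y≉0 , +<+ (n%ℕd<d y N) ,
     ≋⇒≡[mod] (≋-trans (*-cong (≋-sym (≋-%ℕ x)) (≋-sym (≋-%ℕ y))) xy≋a)) ,
    %ℕ-cong (-‿cong₂ (≋-sym (≋-%ℕ x)) (≋-sym (≋-%ℕ y)))
    where
    x≉0 : ¬ (x ≋ 0ℤ [mod N ])
    x≉0 x≋0 = a≉0 (begin
      a      ≈⟨ ≋-sym xy≋a ⟩
      x * y  ≈⟨ *-cong x≋0 (≋-refl y) ⟩
      0ℤ * y ≡⟨⟩
      0ℤ     ∎)
    y≉0 : ¬ (y ≋ 0ℤ [mod N ])
    y≉0 y≋0 = a≉0 (begin
      a      ≈⟨ ≋-sym xy≋a ⟩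
      x * y  ≈⟨ *-cong (≋-refl x) y≋0 ⟩
      x * 0ℤ ≡⟨ ℤ.*-zeroʳ x ⟩
      0ℤ     ∎)

  D̄₂-elim : ∀ {r} → D̄₂ a N r → ∃₂ λ x y → x * y ≋ a [mod N ] × x - y ≋ + r [mod N ]
  D̄₂-elim (x , y , (_ , _ , _ , _ , xy≡a) , x-y%N≡r) =
    x , y , ≡[mod]⇒≋ xy≡a , ≋-trans (≋-%ℕ (x - y)) (≋-reflexive (cong +_ x-y%N≡r))

  D̄₂⇒<N : ∀ {r} → D̄₂ a N r → r ℕ.< N
  D̄₂⇒<N (x , y , _ , x-y%N≡r) = subst (ℕ._< N) x-y%N≡r (n%ℕd<d (x - y) N)

  f∈D̄₂⇒square : ∀ k → D̄₂ a N (f N k) → IsSquareMod (k * k + a) N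
  f∈D̄₂⇒square k 2k∈D̄₂ with D̄₂-elim 2k∈D̄₂
  ... | x , y , xy≋a , x-y≋2k%N = y + k , ≋⇒≡[mod] (begin
    k * k + a                     ≈⟨ +-cong (≋-refl (k * k)) (≋-sym xy≋a) ⟩
    k * k + x * y                 ≡⟨ solve (x ∷ y ∷ k ∷ []) ⟩
    y * y + k * k + y * (x - y)   ≈⟨ +-cong (≋-refl (y * y + k * k)) (*-cong (≋-refl y) x-y≋2k) ⟩
    y * y + k * k + y * (+ 2 * k) ≡⟨ solve (y ∷ k ∷ []) ⟩
    (y + k) * (y + k)             ∎)
    where
    x-y≋2k : x - y ≋ + 2 * k [mod N ]
    x-y≋2k = ≋-trans x-y≋2k%N (≋-sym (≋-%ℕ (+ 2 * k)))

  square⇒f∈D̄₂ : ¬ (a ≋ 0ℤ [mod N ]) → ∀ k → IsSquareMod (k * k + a) N → D̄₂ a N (f N k)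
  square⇒f∈D̄₂ a≉0 k (z , k²+a≡z²) =
    subst (λ d → D̄₂ a N (d %ℕ N)) [z+k]-[z-k]≡2k (D̄₂-intro (z + k) (z - k) a≉0 [z+k][z-k]≋a)
    where
    [z+k]-[z-k]≡2k : (z + k) - (z - k) ≡ + 2 * k
    [z+k]-[z-k]≡2k = solve (z ∷ k ∷ [])
    z²≋k²+a : z * z ≋ k * k + a [mod N ]
    z²≋k²+a = ≋-sym (≡[mod]⇒≋ k²+a≡z²)
    [z+k][z-k]≋a : (z + k) * (z - k) ≋ a [mod N ]
    [z+k][z-k]≋a = begin
      (z + k) * (z - k)   ≡⟨ solve (z ∷ k ∷ []) ⟩
      z * z - k * k       ≈⟨ -‿cong₂ z²≋k²+a (≋-refl (k * k)) ⟩
      (k * k + a) - k * k ≡⟨ solve (k ∷ a ∷ []) ⟩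
      a                   ∎

fBijection-intro : ∀ {a N bound} .{{_ : NonZero N}} → ¬ (a ≋ 0ℤ [mod N ]) →
  (∀ {m m′} → m ℕ.< bound → m′ ℕ.< bound → f N (+ m) ≡ f N (+ m′) → m ≡ m′) →
  (∀ {r} → D̄₂ a N r → ∃ λ m → m ℕ.< bound × f N (+ m) ≡ r) →
  FBijection a N bound
fBijection-intro {a} {N} a≉0 f-injective f-onto = well-defined , injective , surjective
  where
  well-defined : ∀ k → Dom a N _ k → D̄₂ a N (f N k)
  well-defined k (_ , _ , square) = square⇒f∈D̄₂ a a≉0 k square
  injective : ∀ k k′ → Dom a N _ k → Dom a N _ k′ → f N k ≡ f N k′ → k ≡ k′
  injective (+ m) (+ m′) (_ , +<+ m<b , _) (_ , +<+ m′<b , _) fk≡fk′ =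
    cong +_ (f-injective m<b m′<b fk≡fk′)
  surjective : ∀ r → D̄₂ a N r → ∃ λ k → Dom a N _ k × f N k ≡ r
  surjective r r∈D̄₂ with f-onto r∈D̄₂
  ... | m , m<b , fm≡r =
    + m , (+≤+ z≤n , +<+ m<b , f∈D̄₂⇒square a (+ m) (subst (D̄₂ a N) (sym fm≡r) r∈D̄₂))
        , fm≡r

2-invertible-mod-odd : ∀ {N} → ¬ (2 ℕDiv.∣ N) → ∃ λ u → u * + 2 ≋ 1ℤ [mod N ]
2-invertible-mod-odd {N} 2∤N with N % 2 in N%2≡0 | m≡m%n+[m/n]*n N 2 | m%n<n N 2
... | 0           | _       | _ = ⊥-elim (2∤N (ℕDiv.m%n≡0⇒n∣m N 2 N%2≡0))
... | 1           | N≡1+q*2 | _ = + suc q , congruent (Signed.divides 1ℤ (begin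
  + suc q * + 2 - 1ℤ   ≡⟨ cong (_- 1ℤ) (ℤ.pos-* (suc q) 2) ⟨
  + (suc q ℕ.* 2) - 1ℤ ≡⟨⟩
  + (1 ℕ.+ q ℕ.* 2)    ≡⟨ cong +_ N≡1+q*2 ⟨
  + N                  ≡⟨ ℤ.*-identityˡ (+ N) ⟨
  1ℤ * + N             ∎))
  where
  open ≡-Reasoning
  q = N / 2
... | suc (suc _) | _       | s≤s (s≤s ())

fBijection-2-invertible : ∀ {a N} .{{_ : NonZero N}} u → u * + 2 ≋ 1ℤ [mod N ] →
  ¬ (a ≋ 0ℤ [mod N ]) → FBijection a N N
fBijection-2-invertible {a} {N} u 2u≋1 a≉0 = fBijection-intro a≉0 f-injective f-onto
  where
  open SetoidReasoning (≋-setoid N)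
  f-injective : ∀ {m m′} → m ℕ.< N → m′ ℕ.< N → f N (+ m) ≡ f N (+ m′) → m ≡ m′
  f-injective m<N m′<N fm≡fm′ =
    residue-unique m<N m′<N (*-cancelˡ-≋ u (+ 2) 2u≋1 (%ℕ-≡⇒≋ fm≡fm′))
  f-onto : ∀ {r} → D̄₂ a N r → ∃ λ m → m ℕ.< N × f N (+ m) ≡ r
  f-onto {r} r∈D̄₂ =
    m , n%ℕd<d (u * + r) N , trans (%ℕ-cong 2m≋r) (m<n⇒m%n≡m (D̄₂⇒<N a r∈D̄₂))
    where
    m = (u * + r) %ℕ N
    2m≋r : + 2 * + m ≋ + r [mod N ]
    2m≋r = begin
      + 2 * + m       ≈⟨ *-cong (≋-refl (+ 2)) (≋-sym (≋-%ℕ (u * + r))) ⟩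
      + 2 * (u * + r) ≡⟨ ℤ.*-assoc (+ 2) u (+ r) ⟨
      + 2 * u * + r   ≡⟨ cong (_* + r) (ℤ.*-comm (+ 2) u) ⟩
      u * + 2 * + r   ≈⟨ *-cong 2u≋1 (≋-refl (+ r)) ⟩
      1ℤ * + r        ≡⟨ ℤ.*-identityˡ (+ r) ⟩
      + r             ∎

≋0⊎≋1[mod2] : ∀ x → x ≋ 0ℤ [mod 2 ] ⊎ x ≋ 1ℤ [mod 2 ]
≋0⊎≋1[mod2] x with x %ℕ 2 | ≋-%ℕ {2} x | n%ℕd<d x 2
... | 0           | x≋0 | _            = inj₁ x≋0
... | 1           | x≋1 | _            = inj₂ x≋1
... | suc (suc _) | _   | s≤s (s≤s ())

module _ {a : ℤ} (a≉0 : ¬ (a ≋ 0ℤ [mod 2 ])) where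
  open SetoidReasoning (≋-setoid 2)

  odd-factor : ∀ x y → x * y ≋ a [mod 2 ] → x ≋ 1ℤ [mod 2 ]
  odd-factor x y xy≋a with ≋0⊎≋1[mod2] x
  ... | inj₂ x≋1 = x≋1
  ... | inj₁ x≋0 = ⊥-elim (a≉0 (begin
    a      ≈⟨ ≋-sym xy≋a ⟩
    x * y  ≈⟨ *-cong x≋0 (≋-refl y) ⟩
    0ℤ * y ≡⟨⟩
    0ℤ     ∎))

  D̄₂-even : ∀ {N r} .{{_ : NonZero N}} → 2 ℕDiv.∣ N → D̄₂ a N r → 2 ℕDiv.∣ r
  D̄₂-even {r = r} 2∣N r∈D̄₂ with D̄₂-elim a r∈D̄₂
  ... | x , y , xy≋a , x-y≋r = ≋0⇒∣ r≋0
    where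
    xy≋a[mod2] : x * y ≋ a [mod 2 ]
    xy≋a[mod2] = ≋-mod-∣ 2∣N xy≋a
    yx≋a[mod2] : y * x ≋ a [mod 2 ]
    yx≋a[mod2] = ≋-trans (≋-reflexive (ℤ.*-comm y x)) xy≋a[mod2]
    r≋0 : + r ≋ 0ℤ [mod 2 ]
    r≋0 = begin
      + r     ≈⟨ ≋-mod-∣ 2∣N x-y≋r ⟨
      x - y   ≈⟨ -‿cong₂ (odd-factor x y xy≋a[mod2]) (odd-factor y x yx≋a[mod2]) ⟩
      1ℤ - 1ℤ ≡⟨⟩
      0ℤ      ∎

2m<N⇒f≡2m : ∀ {N} .{{_ : NonZero N}} m → 2 ℕ.* m ℕ.< N → f N (+ m) ≡ 2 ℕ.* m
2m<N⇒f≡2m {N} m 2m<N = trans (cong (_%ℕ N) (sym (ℤ.pos-* 2 m))) (m<n⇒m%n≡m 2m<N)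

fBijection-even : ∀ {a} B .{{_ : NonZero (2 ℕ.* B)}} → ¬ (a ≋ 0ℤ [mod 2 ]) →
  FBijection a (2 ℕ.* B) B
fBijection-even {a} B a≉0[mod2] = fBijection-intro a≉0 f-injective f-onto
  where
  N = 2 ℕ.* B
  2∣N : 2 ℕDiv.∣ N
  2∣N = ℕDiv.m∣m*n B
  a≉0 : ¬ (a ≋ 0ℤ [mod N ])
  a≉0 = a≉0[mod2] ∘ ≋-mod-∣ 2∣N
  f-injective : ∀ {m m′} → m ℕ.< B → m′ ℕ.< B → f N (+ m) ≡ f N (+ m′) → m ≡ m′
  f-injective {m} {m′} m<B m′<B fm≡fm′ = ℕ.*-cancelˡ-≡ m m′ 2 (begin
    2 ℕ.* m    ≡⟨ 2m<N⇒f≡2m m (ℕ.*-monoʳ-< 2 m<B) ⟨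
    f N (+ m)  ≡⟨ fm≡fm′ ⟩
    f N (+ m′) ≡⟨ 2m<N⇒f≡2m m′ (ℕ.*-monoʳ-< 2 m′<B) ⟩
    2 ℕ.* m′   ∎)
    where open ≡-Reasoning
  f-onto : ∀ {r} → D̄₂ a N r → ∃ λ m → m ℕ.< B × f N (+ m) ≡ r
  f-onto {r} r∈D̄₂ = halve (D̄₂-even a≉0[mod2] 2∣N r∈D̄₂)
    where
    halve : 2 ℕDiv.∣ r → ∃ λ m → m ℕ.< B × f N (+ m) ≡ r
    halve (ℕDiv.divides j r≡j*2) =
      j , ℕ.*-cancelˡ-< 2 j B 2j<N , trans (2m<N⇒f≡2m j 2j<N) (sym r≡2j)
      where
      r≡2j : r ≡ 2 ℕ.* j
      r≡2j = trans r≡j*2 (ℕ.*-comm j 2)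
      2j<N : 2 ℕ.* j ℕ.< N
      2j<N = subst (ℕ._< N) r≡2j (D̄₂⇒<N a r∈D̄₂)

prime∣m^n⇒prime∣m : ∀ {d m} n → Prime d → d ℕDiv.∣ m ^ n → d ℕDiv.∣ m
prime∣m^n⇒prime∣m zero d-prime d∣1 =
  ⊥-elim (¬prime[1] (subst Prime (ℕDiv.∣1⇒≡1 d∣1) d-prime))
prime∣m^n⇒prime∣m {m = m} (suc n) d-prime d∣m^[1+n]
  with euclidsLemma m (m ^ n) d-prime d∣m^[1+n]
... | inj₁ d∣m   = d∣m
... | inj₂ d∣m^n = prime∣m^n⇒prime∣m n d-prime d∣m^n

odd-prime^n-odd : ∀ {p} n → Prime p → p ≢ 2 → ¬ (2 ℕDiv.∣ p ^ n)
odd-prime^n-odd n p-prime p≢2 2∣p^n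
  with prime⇒irreducible p-prime (prime∣m^n⇒prime∣m n prime[2] 2∣p^n)
... | inj₁ ()
... | inj₂ 2≡p = p≢2 (sym 2≡p)

lemma2p3 : (p t : ℕ) (a : ℤ) → Prime p → 1 ≤ t → ¬ (+ p ∣ a) → .{{_ : NonZero (p ^ t)}} →
    ((k : ℤ) → D̄₂ a (p ^ t) (f (p ^ t) k) ⇔ IsSquareMod (k * k + a) (p ^ t))
    × (p ≢ 2 → FBijection a (p ^ t) (p ^ t))
    × (p ≡ 2 → FBijection a (p ^ t) (2 ^ (t ∸ 1)))
lemma2p3 p (suc t) a p-prime (s≤s z≤n) p∤a =
    (λ k → mk⇔ (f∈D̄₂⇒square a k) (square⇒f∈D̄₂ a a≉0 k))
  , (λ p≢2 → let u , 2u≋1 = 2-invertible-mod-odd (odd-prime^n-odd (suc t) p-prime p≢2)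
             in fBijection-2-invertible u 2u≋1 a≉0)
  , λ { refl → fBijection-even (2 ^ t) (p∤a ∘ ≋0⇒∣) }
  where
  a≉0 : ¬ (a ≋ 0ℤ [mod p ^ suc t ])
  a≉0 = p∤a ∘ ≋0⇒∣ ∘ ≋-mod-∣ (ℕDiv.m∣m*n (p ^ t))
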